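{- Let $\mathcal{CS}$ be a constant specification for $\mathsf{LP}^{\mathsf{C}}_h$. For every formula $A$ of the language of $\mathsf{LP}_h$, if $\mathsf{LP}^{\mathsf{C}}_h(\mathcal{CS})\vdash A$, then $\mathsf{LP}_h(\mathcal{CS}^\times)\vdash A$.
   Context: Fix a number $h\ge 1$ of agents. Throughout, $i$ ranges over $\{1,\dots,h\}$, $*$ over $\{1,\dots,h,\mathsf{C}\}$, and $\circledast$ over $\{1,\dots,h,\mathsf{E},\mathsf{C}\}$. For each $\circledast$ let $\mathrm{Cons}_\circledast$ (proof constants) and $\mathrm{Var}_\circledast$ (proof variables) be countably infinite sets, all pairwise disjoint. Evidence terms $\mathrm{Tm}_1,\dots,\mathrm{Tm}_h,\mathrm{Tm}_{\mathsf{E}},\mathrm{Tm}_{\mathsf{C}}$ are defined by simultaneous induction: $\mathrm{Cons}_\circledast\cup\mathrm{Var}_\circledast\subseteq\mathrm{Tm}_\circledast$; if $t\in\mathrm{Tm}_i$ then $!_i t\in\mathrm{Tm}_i$; if $t,s\in\mathrm{Tm}_*$ then $t+_*s,\ t\cdot_* s\in\mathrm{Tm}_*$; if $t_1\in\mathrm{Tm}_1,\dots,t_h\in\mathrm{Tm}_h$ then $\langle t_1,\dots,t_h\rangle\in\mathrm{Tm}_{\mathsf{E}}$; if $t\in\mathrm{Tm}_{\mathsf{E}}$ then $\pi_i t\in\mathrm{Tm}_i$; if $t\in\mathrm{Tm}_{\mathsf{C}}$ then $\mathsf{hd}(t),\mathsf{tl}(t)\in\mathrm{Tm}_{\mathsf{E}}$;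 if $t\in\mathrm{Tm}_{\mathsf{C}}$ and $s\in\mathrm{Tm}_{\mathsf{E}}$ then $\mathsf{ind}(t,s)\in\mathrm{Tm}_{\mathsf{C}}$. Formulae are built from a countable set $\mathrm{Prop}$ of propositional variables using $\neg,\wedge,\vee,\to$ and the rule: if $A$ is a formula and $t\in\mathrm{Tm}_\circledast$ then $t{:}_\circledast A$ is a formula (indices on $!,+,\cdot$ omitted when clear). Axioms of $\mathsf{LP}^{\mathsf{C}}_h$ (all instances): (1) propositional tautologies; (2) $t{:}_*(A\to B)\to(s{:}_*A\to (t\cdot s){:}_*B)$; (3) $t{:}_*A\to(t+s){:}_*A$ and $s{:}_*A\to(t+s){:}_*A$; (4) $t{:}_iA\to A$; (5) $t{:}_iA\to (!t){:}_i\, t{:}_iA$; (6) $t_1{:}_1A\wedge\dots\wedge t_h{:}_hA\to\langle t_1,\dots,t_h\rangle{:}_{\mathsf{E}}A$; (7) $t{:}_{\mathsf{E}}A\to (\pi_it){:}_iA$; (8) $t{:}_{\mathsf{C}}A\to\mathsf{hd}(t){:}_{\mathsf{E}}A$ and $t{:}_{\mathsf{C}}A\to\mathsf{tl}(t){:}_{\mathsf{E}}\,t{:}_{\mathsf{C}}A$; (9) $A\wedge t{:}_{\mathsf{C}}(A\to s{:}_{\mathsf{E}}A)\to\mathsf{ind}(t,s){:}_{\mathsf{C}}A$. A constant specification $\mathcal{CS}$ for $\mathsf{LP}^{\mathsf{C}}_h$ is any set of formulae $c{:}_\circledast A$ with $c\in\mathrm{Cons}_\circledast$ and $A$ an axiom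 of $\mathsf{LP}^{\mathsf{C}}_h$. $\mathsf{LP}^{\mathsf{C}}_h(\mathcal{CS})$ is the Hilbert system with these axioms, modus ponens, and axiom necessitation (derive $c{:}_\circledast A$ whenever $c{:}_\circledast A\in\mathcal{CS}$). The language of $\mathsf{LP}_h$: terms are built only from $\mathrm{Cons}_i,\mathrm{Var}_i$ using $!_i,+_i,\cdot_i$ (no terms of $\mathrm{Tm}_{\mathsf{E}}$ or $\mathrm{Tm}_{\mathsf{C}}$, no tupling, projections, $\mathsf{hd},\mathsf{tl},\mathsf{ind}$), and formulae use only $t{:}_iA$ with such terms. Its axioms are (1) propositional tautologies and, for each agent $i$, (2) $t{:}_i(A\to B)\to(s{:}_iA\to (t\cdot s){:}_iB)$, (3) $t{:}_iA\to(t+s){:}_iA$, $s{:}_iA\to(t+s){:}_iA$, (4) $t{:}_iA\to A$, (5) $t{:}_iA\to(!t){:}_it{:}_iA$, all in the $\mathsf{LP}_h$ language. The translation ${}^\times$ from $\mathsf{LP}^{\mathsf{C}}_h$-formulae to $\mathsf{LP}_h$-formulae: $P^\times=P$ for $P\in\mathrm{Prop}$; ${}^\times$ commutes with propositional connectives; $(t{:}_\circledast A)^\times=A^\times$ if $t$ contains a subterm belonging to $\mathrm{Tm}_{\mathsf{E}}\cup\mathrm{Tm}_{\mathsf{C}}$ (including $t$ itself), and $(t{:}_\circledast A)^\times=t{:}_\circledast A^\times$ otherwise. $\mathcal{CS}^\times:=\{D^\times: D\in\mathcal{CS}\}$. $\mathsf{LP}_h(\mathcal{CS}^\times)$ is the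 Hilbert system with the $\mathsf{LP}_h$ axioms, modus ponens, and the rule deriving (from no premises) each formula $c{:}_iB\in\mathcal{CS}^\times$. -}

module Defs where

open import Data.Nat using (ℕ; suc)
open import Data.Fin using (Fin; zero; suc)
open import Data.List using (List; []; _∷_; map; allFin)
open import Data.Bool using (Bool; true; false; not; _∧_; _∨_)
open import Data.Maybe using (Maybe; just; nothing)
open import Data.Product using (Σ; _×_; _,_)
open import Relation.Binary.PropositionalEquality using (_≡_)

-- Everything is parametrised by n, with the number of agents h = suc n
-- (this encodes the standing assumption h ≥ 1).
-- Proof constants, proof variables (of every sort) and propositional
-- variables are indexed by ℕ (countably infinite sets; sorts kept apart by
-- the sort index of the term).
module LP (n : ℕ) where

  h : ℕ
  h = suc n

  Agent : Set
  Agent = Fin h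

  data Sort : Set where
    ag : Agent → Sort
    E  : Sort
    C  : Sort

  data IsStar : Sort → Set where
    ag★ : ∀ {i} → IsStar (ag i)
    C★  : IsStar C

  data Tm : Sort → Set where
    cst  : ∀ {s} → ℕ → Tm s
    var  : ∀ {s} → ℕ → Tm s
    bang : ∀ {i} → Tm (ag i) → Tm (ag i)
    plus : ∀ {s} → IsStar s → Tm s → Tm s → Tm s
    app  : ∀ {s} → IsStar s → Tm s → Tm s → Tm s
    tup  : ((i : Agent) → Tm (ag i)) → Tm E
    prj  : (i : Agent) → Tm E → Tm (ag i)
    hd   : Tm C → Tm E
    tl   : Tm C → Tm E
    ind  : Tm C → Tm E → Tm C

  infixr 5 _⇒_
  infixl 6 _∧'_ _∨'_

  data Fm : Set where
    atom  : ℕ → Fm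
    ¬'_   : Fm → Fm
    _∧'_  : Fm → Fm → Fm
    _∨'_  : Fm → Fm → Fm
    _⇒_   : Fm → Fm → Fm
    jst   : (s : Sort) → Tm s → Fm → Fm

  evalC : (ℕ → Bool) → ((s : Sort) → Tm s → Fm → Bool) → Fm → Bool
  evalC pv jv (atom p)  = pv p
  evalC pv jv (¬' A)    = not (evalC pv jv A)
  evalC pv jv (A ∧' B)  = evalC pv jv A ∧ evalC pv jv B
  evalC pv jv (A ∨' B)  = evalC pv jv A ∨ evalC pv jv B
  evalC pv jv (A ⇒ B)   = not (evalC pv jv A) ∨ evalC pv jv B
  evalC pv jv (jst s t A) = jv s t A

  TautC : Fm → Set
  TautC A = ∀ pv jv → evalC pv jv A ≡ true

  conjFrom : Fm → List Fm → Fm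
  conjFrom a []       = a
  conjFrom a (b ∷ bs) = conjFrom (a ∧' b) bs

  bigConj : (Agent → Fm) → Fm
  bigConj f = conjFrom (f zero) (map (λ k → f (suc k)) (allFin n))

  data AxC : Fm → Set where
    ax1  : ∀ {A} → TautC A → AxC A
    ax2  : ∀ {s} (p : IsStar s) (t u : Tm s) (A B : Fm) →
           AxC (jst s t (A ⇒ B) ⇒ (jst s u A ⇒ jst s (app p t u) B))
    ax3l : ∀ {s} (p : IsStar s) (t u : Tm s) (A : Fm) →
           AxC (jst s t A ⇒ jst s (plus p t u) A)
    ax3r : ∀ {s} (p : IsStar s) (t u : Tm s) (A : Fm) →
           AxC (jst s u A ⇒ jst s (plus p t u) A)
    ax4  : ∀ (i : Agent) (t : Tm (ag i)) (A : Fm) → AxC (jst (ag i) t A ⇒ A)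
    ax5  : ∀ (i : Agent) (t : Tm (ag i)) (A : Fm) →
           AxC (jst (ag i) t A ⇒ jst (ag i) (bang t) (jst (ag i) t A))
    ax6  : ∀ (ts : (i : Agent) → Tm (ag i)) (A : Fm) →
           AxC (bigConj (λ i → jst (ag i) (ts i) A) ⇒ jst E (tup ts) A)
    ax7  : ∀ (i : Agent) (t : Tm E) (A : Fm) →
           AxC (jst E t A ⇒ jst (ag i) (prj i t) A)
    ax8h : ∀ (t : Tm C) (A : Fm) → AxC (jst C t A ⇒ jst E (hd t) A)
    ax8t : ∀ (t : Tm C) (A : Fm) →
           AxC (jst C t A ⇒ jst E (tl t) (jst C t A))
    ax9  : ∀ (t : Tm C) (s : Tm E) (A : Fm) →
           AxC ((A ∧' jst C t (A ⇒ jst E s A)) ⇒ jst C (ind t s) A)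

  -- A constant specification: a set of formulas c :_⊛ A with c ∈ Cons_⊛ and
  -- A an axiom; (s , c , A) ∈ CS stands for the formula  cst c :_s A.
  record ConstSpec : Set₁ where
    field
      mem   : (s : Sort) → ℕ → Fm → Set
      isAx  : ∀ {s c A} → mem s c A → AxC A

  open ConstSpec public

  data _⊢C_ (CS : ConstSpec) : Fm → Set where
    axiom : ∀ {A} → AxC A → CS ⊢C A
    mp    : ∀ {A B} → CS ⊢C (A ⇒ B) → CS ⊢C A → CS ⊢C B
    nec   : ∀ {s c A} → mem CS s c A → CS ⊢C jst s (cst c) A

  data TmH : Agent → Set where
    cst  : ∀ {i} → ℕ → TmH i
    var  : ∀ {i} → ℕ → TmH i
    bang : ∀ {i} → TmH i → TmH i
    plus : ∀ {i} → TmH i → TmH i → TmH i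
    app  : ∀ {i} → TmH i → TmH i → TmH i

  data FmH : Set where
    atom  : ℕ → FmH
    ¬'_   : FmH → FmH
    _∧'_  : FmH → FmH → FmH
    _∨'_  : FmH → FmH → FmH
    _⇒_   : FmH → FmH → FmH
    jst   : (i : Agent) → TmH i → FmH → FmH

  evalH : (ℕ → Bool) → ((i : Agent) → TmH i → FmH → Bool) → FmH → Bool
  evalH pv jv (atom p)  = pv p
  evalH pv jv (¬' A)    = not (evalH pv jv A)
  evalH pv jv (A ∧' B)  = evalH pv jv A ∧ evalH pv jv B
  evalH pv jv (A ∨' B)  = evalH pv jv A ∨ evalH pv jv B
  evalH pv jv (A ⇒ B)   = not (evalH pv jv A) ∨ evalH pv jv B
  evalH pv jv (jst i t A) = jv i t A

  TautH : FmH → Set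
  TautH A = ∀ pv jv → evalH pv jv A ≡ true

  data AxH : FmH → Set where
    ax1  : ∀ {A} → TautH A → AxH A
    ax2  : ∀ (i : Agent) (t u : TmH i) (A B : FmH) →
           AxH (jst i t (A ⇒ B) ⇒ (jst i u A ⇒ jst i (app t u) B))
    ax3l : ∀ (i : Agent) (t u : TmH i) (A : FmH) →
           AxH (jst i t A ⇒ jst i (plus t u) A)
    ax3r : ∀ (i : Agent) (t u : TmH i) (A : FmH) →
           AxH (jst i u A ⇒ jst i (plus t u) A)
    ax4  : ∀ (i : Agent) (t : TmH i) (A : FmH) → AxH (jst i t A ⇒ A)
    ax5  : ∀ (i : Agent) (t : TmH i) (A : FmH) →
           AxH (jst i t A ⇒ jst i (bang t) (jst i t A))

  embT : ∀ {i} → TmH i → Tm (ag i)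
  embT (cst c)    = cst c
  embT (var x)    = var x
  embT (bang t)   = bang (embT t)
  embT (plus t u) = plus ag★ (embT t) (embT u)
  embT (app t u)  = app ag★ (embT t) (embT u)

  emb : FmH → Fm
  emb (atom p)    = atom p
  emb (¬' A)      = ¬' emb A
  emb (A ∧' B)    = emb A ∧' emb B
  emb (A ∨' B)    = emb A ∨' emb B
  emb (A ⇒ B)     = emb A ⇒ emb B
  emb (jst i t A) = jst (ag i) (embT t) (emb A)

  toH : ∀ {i} → Tm (ag i) → Maybe (TmH i)
  toH (cst c)  = just (cst c)
  toH (var x)  = just (var x)
  toH (bang t) with toH t
  ... | just t' = just (bang t')
  ... | nothing = nothing
  toH (plus _ t u) with toH t | toH u
  ... | just t' | just u' = just (plus t' u')
  ... | _       | _       = nothing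
  toH (app _ t u) with toH t | toH u
  ... | just t' | just u' = just (app t' u')
  ... | _       | _       = nothing
  toH (prj j t) = nothing

  jstX : (s : Sort) → Tm s → FmH → FmH
  jstX (ag i) t B with toH t
  ... | just t' = jst i t' B
  ... | nothing = B
  jstX E t B = B
  jstX C t B = B

  _ˣ : Fm → FmH
  atom p ˣ      = atom p
  (¬' A) ˣ      = ¬' (A ˣ)
  (A ∧' B) ˣ    = (A ˣ) ∧' (B ˣ)
  (A ∨' B) ˣ    = (A ˣ) ∨' (B ˣ)
  (A ⇒ B) ˣ     = (A ˣ) ⇒ (B ˣ)
  jst s t A ˣ   = jstX s t (A ˣ)

  InCSˣ : ConstSpec → FmH → Set
  InCSˣ CS F = Σ Sort λ s → Σ ℕ λ c → Σ Fm λ A →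
                 mem CS s c A × (jst s (cst c) A ˣ ≡ F)

  data _⊢H_ (CS : ConstSpec) : FmH → Set where
    axiom : ∀ {A} → AxH A → CS ⊢H A
    mp    : ∀ {A B} → CS ⊢H (A ⇒ B) → CS ⊢H A → CS ⊢H B
    nec   : ∀ {i c B} → InCSˣ CS (jst i (cst c) B) → CS ⊢H jst i (cst c) B

-- The translation ˣ erases every justification term built with tupling,
-- projections, hd, tl or ind, keeping only the justified formula.  It sends
-- each axiom of LP^C_h to a theorem of LP_h: erased justifications become
-- trivial implications, and the surviving ones are LP_h axioms or factivity.
-- It commutes with modus ponens, and necessitation either lands in CS^× (for
-- an agent) or yields the translation of an axiom (for E and C).  Since ˣ
-- undoes the embedding of LP_h-formulas, derivations of emb A translate to
-- derivations of A.
module Submission where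

open import Defs
open import Data.Nat using (ℕ)
open import Data.Bool using (Bool; true; false; not; _∧_; _∨_)
open import Data.Bool.Properties using (∨-zeroʳ; ∨-inverseˡ; ∧-conicalˡ)
open import Data.Maybe using (just; nothing)
open import Data.List using ([]; _∷_; map; allFin)
open import Data.Fin using (zero; suc)
open import Data.Product using (_,_)
open import Relation.Binary.PropositionalEquality using (_≡_; refl; sym; trans; cong; cong₂; subst)

implication-true : ∀ {x y : Bool} → (x ≡ true → y ≡ true) → not x ∨ y ≡ true
implication-true {false} _ = refl
implication-true {true}  f = f refl

syllogism-true : ∀ x y z → not (not x ∨ y) ∨ (not (not y ∨ z) ∨ (not x ∨ z)) ≡ true
syllogism-true false y     z = ∨-zeroʳ (not (not y ∨ z))
syllogism-true true  false z = refl
syllogism-true true  true  z = ∨-inverseˡ z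

module _ (n : ℕ) where
  open LP n

  jvˣ : (ℕ → Bool) → ((i : Agent) → TmH i → FmH → Bool) → (s : Sort) → Tm s → Fm → Bool
  jvˣ pv jv s t B = evalH pv jv (jstX s t (B ˣ))

  evalC-ˣ : ∀ pv jv A → evalC pv (jvˣ pv jv) A ≡ evalH pv jv (A ˣ)
  evalC-ˣ pv jv (atom p)    = refl
  evalC-ˣ pv jv (¬' A)      = cong not (evalC-ˣ pv jv A)
  evalC-ˣ pv jv (A ∧' B)    = cong₂ _∧_ (evalC-ˣ pv jv A) (evalC-ˣ pv jv B)
  evalC-ˣ pv jv (A ∨' B)    = cong₂ _∨_ (evalC-ˣ pv jv A) (evalC-ˣ pv jv B)
  evalC-ˣ pv jv (A ⇒ B)     = cong₂ (λ x y → not x ∨ y) (evalC-ˣ pv jv A) (evalC-ˣ pv jv B)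
  evalC-ˣ pv jv (jst s t A) = refl

  TautC⇒TautHˣ : ∀ {A} → TautC A → TautH (A ˣ)
  TautC⇒TautHˣ {A} taut pv jv = trans (sym (evalC-ˣ pv jv A)) (taut pv (jvˣ pv jv))

  conjFromˣ-head : ∀ pv jv a bs → evalH pv jv (conjFrom a bs ˣ) ≡ true → evalH pv jv (a ˣ) ≡ true
  conjFromˣ-head pv jv a []       holds = holds
  conjFromˣ-head pv jv a (b ∷ bs) holds =
    ∧-conicalˡ (evalH pv jv (a ˣ)) (evalH pv jv (b ˣ)) (conjFromˣ-head pv jv (a ∧' b) bs holds)

  bigConjˣ-head : ∀ pv jv f → evalH pv jv (bigConj f ˣ) ≡ true → evalH pv jv (f zero ˣ) ≡ true
  bigConjˣ-head pv jv f = conjFromˣ-head pv jv (f zero) (map (λ k → f (suc k)) (allFin n))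

  toH-embT : ∀ {i} (t : TmH i) → toH (embT t) ≡ just t
  toH-embT (cst c)    = refl
  toH-embT (var x)    = refl
  toH-embT (bang t)   rewrite toH-embT t = refl
  toH-embT (plus t u) rewrite toH-embT t | toH-embT u = refl
  toH-embT (app t u)  rewrite toH-embT t | toH-embT u = refl

  ˣ-emb : ∀ A → emb A ˣ ≡ A
  ˣ-emb (atom p)    = refl
  ˣ-emb (¬' A)      = cong ¬'_ (ˣ-emb A)
  ˣ-emb (A ∧' B)    = cong₂ _∧'_ (ˣ-emb A) (ˣ-emb B)
  ˣ-emb (A ∨' B)    = cong₂ _∨'_ (ˣ-emb A) (ˣ-emb B)
  ˣ-emb (A ⇒ B)     = cong₂ _⇒_ (ˣ-emb A) (ˣ-emb B)
  ˣ-emb (jst i t A) rewrite toH-embT t = cong (jst i t) (ˣ-emb A)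

  module _ (CS : ConstSpec) where

    ⊢-entailment : ∀ {A B} → (∀ pv jv → evalH pv jv A ≡ true → evalH pv jv B ≡ true) →
                   CS ⊢H (A ⇒ B)
    ⊢-entailment entails = axiom (ax1 λ pv jv → implication-true (entails pv jv))

    ⊢-id : ∀ {A} → CS ⊢H (A ⇒ A)
    ⊢-id = ⊢-entailment λ _ _ holds → holds

    ⊢-syllogism : ∀ {X Y Z} → CS ⊢H ((X ⇒ Y) ⇒ ((Y ⇒ Z) ⇒ (X ⇒ Z)))
    ⊢-syllogism {X} {Y} {Z} =
      axiom (ax1 λ pv jv → syllogism-true (evalH pv jv X) (evalH pv jv Y) (evalH pv jv Z))

    ⊢-trans : ∀ {X Y Z} → CS ⊢H (X ⇒ Y) → CS ⊢H (Y ⇒ Z) → CS ⊢H (X ⇒ Z)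
    ⊢-trans d e = mp (mp ⊢-syllogism d) e

    ⊢-precompose : ∀ {Q A B} → CS ⊢H (Q ⇒ A) → CS ⊢H ((A ⇒ B) ⇒ (Q ⇒ B))
    ⊢-precompose = mp ⊢-syllogism

    ⊢-jstˣ-factive : ∀ i t B → CS ⊢H (jstX (ag i) t B ⇒ B)
    ⊢-jstˣ-factive i t B with toH t
    ... | just t' = axiom (ax4 i t' B)
    ... | nothing = ⊢-id

    ⊢-axiomˣ : ∀ {A} → AxC A → CS ⊢H (A ˣ)
    ⊢-axiomˣ (ax1 {A} taut) = axiom (ax1 (TautC⇒TautHˣ {A} taut))
    ⊢-axiomˣ (ax2 {ag i} ag★ t u A B) with toH t | toH u
    ... | just t' | just u' = axiom (ax2 i t' u' (A ˣ) (B ˣ))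
    ... | just t' | nothing = axiom (ax4 i t' _)
    ... | nothing | just u' = ⊢-precompose (axiom (ax4 i u' _))
    ... | nothing | nothing = ⊢-id
    ⊢-axiomˣ (ax2 C★ t u A B) = ⊢-id
    ⊢-axiomˣ (ax3l {ag i} ag★ t u A) with toH t | toH u
    ... | just t' | just u' = axiom (ax3l i t' u' (A ˣ))
    ... | just t' | nothing = axiom (ax4 i t' _)
    ... | nothing | _       = ⊢-id
    ⊢-axiomˣ (ax3l C★ t u A) = ⊢-id
    ⊢-axiomˣ (ax3r {ag i} ag★ t u A) with toH t | toH u
    ... | just t' | just u' = axiom (ax3r i t' u' (A ˣ))
    ... | just t' | nothing = ⊢-id
    ... | nothing | just u' = axiom (ax4 i u' _)
    ... | nothing | nothing = ⊢-id
    ⊢-axiomˣ (ax3r C★ t u A) = ⊢-id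
    ⊢-axiomˣ (ax4 i t A) = ⊢-jstˣ-factive i t (A ˣ)
    ⊢-axiomˣ (ax5 i t A) with toH t
    ... | just t' = axiom (ax5 i t' (A ˣ))
    ... | nothing = ⊢-id
    ⊢-axiomˣ (ax6 ts A) =
      ⊢-trans (⊢-entailment λ pv jv → bigConjˣ-head pv jv λ i → jst (ag i) (ts i) A)
              (⊢-jstˣ-factive zero (ts zero) (A ˣ))
    ⊢-axiomˣ (ax7 i t A) = ⊢-id
    ⊢-axiomˣ (ax8h t A)  = ⊢-id
    ⊢-axiomˣ (ax8t t A)  = ⊢-id
    ⊢-axiomˣ (ax9 t s A) = ⊢-entailment λ pv jv → ∧-conicalˡ _ _

    ⊢ˣ : ∀ {A} → CS ⊢C A → CS ⊢H (A ˣ)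
    ⊢ˣ (axiom ax) = ⊢-axiomˣ ax
    ⊢ˣ (mp d e)   = mp (⊢ˣ d) (⊢ˣ e)
    ⊢ˣ (nec {ag i} {c} {A} m) = nec (ag i , c , A , m , refl)
    ⊢ˣ (nec {E} m) = ⊢-axiomˣ (isAx CS m)
    ⊢ˣ (nec {C} m) = ⊢-axiomˣ (isAx CS m)

theorem3 : (n : ℕ) → let open LP n in
    (CS : ConstSpec) (A : FmH) → CS ⊢C emb A → CS ⊢H A
theorem3 n CS A d = subst (LP._⊢H_ n CS) (ˣ-emb n A) (⊢ˣ n CS d)
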